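{- Let $\Sigma$ be a finite alphabet. A set $S$ of unranked trees over $\Sigma$ is definable by a sentence of MSO that is $<$-invariant over the class of all unranked trees over $\Sigma$ if and only if $S$ is definable by a sentence of MSO that is sibling-order-invariant over the class of all unranked trees over $\Sigma$.
   Context: An unranked tree domain $D$ is a finite, prefix-closed set of words over the positive integers such that $s\cdot i\in D$ implies $s\cdot j\in D$ for all $1\le j<i$. An unranked tree over $\Sigma$ is a structure $T=(D,\prec,(P_a)_{a\in\Sigma})$ where $D$ is an unranked tree domain, $\prec$ is the descendant relation ($s\prec s\cdot s'$ for every $s\cdot s'\in D$ with $s'$ nonempty), and the sets $P_a$ partition $D$ (node labels). A linear order on $T$ is any linear order on $D$. A sibling order on $T$ is a binary relation $\lessdot$ on $D$ such that $s'\lessdot s''$ implies $s'=s\cdot i$, $s''=s\cdot j$ for some node $s$ and distinct $i,j$, and for each node $s$, $\lessdot$ restricted to the children $\{s\cdot i\in D\}$ of $s$ is a linear order. An MSO sentence $\phi$ over the tree vocabulary extended with a binary symbol $R$ is $<$-invariant (resp. sibling-order-invariant) over trees if for every unranked tree $T$ and any two linear orders (resp. sibling orders) $R_1,R_2$ on $T$, $(T,R_1)\models\phi$ iff $(T,R_2)\models\phi$; it then defines the set of trees $T$ such that $(T,R)\models\phi$ for some (equivalently all) such $R$. -}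

module Defs where

open import Data.Nat using (ℕ; zero; suc; _≤_; _<_; _<ᵇ_)
import Data.Nat as ℕ
open import Data.Fin using (Fin)
import Data.Fin as Fin
open import Data.Bool using (Bool; true; false; _∧_; _∨_; not; if_then_else_)
open import Data.List using (List; []; _∷_; _++_; [_]; length; map)
open import Data.Bool.ListAction using (any)
open import Data.List.Membership.Propositional using (_∈_)
open import Data.List.Relation.Unary.All using (All)
import Data.List.Properties as LP
open import Data.Product using (Σ; ∃; _×_; _,_)
open import Data.Sum using (_⊎_)
open import Relation.Nullary using (¬_)
open import Relation.Nullary.Decidable using (⌊_⌋)
open import Relation.Binary.PropositionalEquality using (_≡_; _≢_)
open import Function.Bundles using (_⇔_)

-- Words over ℕ (nodes); children of s are s ++ [ i ] with i ≥ 1.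
Word : Set
Word = List ℕ

_=w_ : Word → Word → Bool
s =w t = ⌊ LP.≡-dec ℕ._≟_ s t ⌋

-- An unranked tree over Σ = Fin k:  D is a finite set of words given by a list,
-- the partition (P_a) of D is given by a labelling function (values off D irrelevant).
record UTree (k : ℕ) : Set where
  field
    dom           : List Word
    label         : Word → Fin k
    positive      : ∀ {s} → s ∈ dom → All (1 ≤_) s
    prefixClosed  : ∀ {s t} → (s ++ t) ∈ dom → s ∈ dom
    siblingClosed : ∀ {s i j} → (s ++ [ i ]) ∈ dom → 1 ≤ j → j < i → (s ++ [ j ]) ∈ dom
open UTree public

isPrefix : Word → Word → Bool
isPrefix []       _        = true
isPrefix (x ∷ s)  []       = false
isPrefix (x ∷ s)  (y ∷ t)  = ⌊ x ℕ.≟ y ⌋ ∧ isPrefix s t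

isStrictPrefix : Word → Word → Bool
isStrictPrefix s t = isPrefix s t ∧ (length s <ᵇ length t)

-- MSO formulas over the tree vocabulary extended by a binary symbol R.
-- First-order variables and second-order variables are both named by ℕ
-- (separate namespaces).
data Formula (k : ℕ) : Set where
  lab   : Fin k → ℕ → Formula k
  desc  : ℕ → ℕ → Formula k
  rel   : ℕ → ℕ → Formula k
  eq    : ℕ → ℕ → Formula k
  mem   : ℕ → ℕ → Formula k
  neg   : Formula k → Formula k
  conj  : Formula k → Formula k → Formula k
  ex1   : ℕ → Formula k → Formula k
  ex2   : ℕ → Formula k → Formula k

elemℕ : ℕ → List ℕ → Bool
elemℕ n xs = any (λ m → ⌊ n ℕ.≟ m ⌋) xs

closedIn : ∀ {k} → List ℕ → List ℕ → Formula k → Bool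
closedIn b1 b2 (lab a x)  = elemℕ x b1
closedIn b1 b2 (desc x y) = elemℕ x b1 ∧ elemℕ y b1
closedIn b1 b2 (rel x y)  = elemℕ x b1 ∧ elemℕ y b1
closedIn b1 b2 (eq x y)   = elemℕ x b1 ∧ elemℕ y b1
closedIn b1 b2 (mem x X)  = elemℕ x b1 ∧ elemℕ X b2
closedIn b1 b2 (neg φ)    = closedIn b1 b2 φ
closedIn b1 b2 (conj φ ψ) = closedIn b1 b2 φ ∧ closedIn b1 b2 ψ
closedIn b1 b2 (ex1 x φ)  = closedIn (x ∷ b1) b2 φ
closedIn b1 b2 (ex2 X φ)  = closedIn b1 (X ∷ b2) φ

Sentence : ∀ {k} → Formula k → Set
Sentence φ = closedIn [] [] φ ≡ true

subsets : ∀ {A : Set} → List A → List (List A)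
subsets []       = [ [] ]
subsets (x ∷ xs) = let r = subsets xs in map (x ∷_) r ++ r

update : ∀ {A : Set} → (ℕ → A) → ℕ → A → ℕ → A
update e x a y = if ⌊ y ℕ.≟ x ⌋ then a else e y

elemW : Word → List Word → Bool
elemW s S = any (s =w_) S

sat : ∀ {k} (T : UTree k) (R : Word → Word → Bool)
      → (ℕ → Word) → (ℕ → List Word) → Formula k → Bool
sat T R e1 e2 (lab a x)  = ⌊ label T (e1 x) Fin.≟ a ⌋
sat T R e1 e2 (desc x y) = isStrictPrefix (e1 x) (e1 y)
sat T R e1 e2 (rel x y)  = R (e1 x) (e1 y)
sat T R e1 e2 (eq x y)   = e1 x =w e1 y
sat T R e1 e2 (mem x X)  = elemW (e1 x) (e2 X)
sat T R e1 e2 (neg φ)    = not (sat T R e1 e2 φ)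
sat T R e1 e2 (conj φ ψ) = sat T R e1 e2 φ ∧ sat T R e1 e2 ψ
sat T R e1 e2 (ex1 x φ)  = any (λ s → sat T R (update e1 x s) e2 φ) (dom T)
sat T R e1 e2 (ex2 X φ)  = any (λ S → sat T R e1 (update e2 X S) φ) (subsets (dom T))

_,_⊨_ : ∀ {k} → UTree k → (Word → Word → Bool) → Formula k → Set
T , R ⊨ φ = sat T R (λ _ → []) (λ _ → []) φ ≡ true

record IsLinearOrder {k} (T : UTree k) (R : Word → Word → Bool) : Set where
  field
    onDom  : ∀ s t → R s t ≡ true → s ∈ dom T × t ∈ dom T
    irrefl : ∀ s → R s s ≡ false
    trans  : ∀ s t u → R s t ≡ true → R t u ≡ true → R s u ≡ true
    total  : ∀ s t → s ∈ dom T → t ∈ dom T → s ≢ t → R s t ≡ true ⊎ R t s ≡ true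

record IsSiblingOrder {k} (T : UTree k) (R : Word → Word → Bool) : Set where
  field
    shape : ∀ s′ s″ → R s′ s″ ≡ true →
            Σ Word λ s → Σ ℕ λ i → Σ ℕ λ j →
              s′ ≡ s ++ [ i ] × s″ ≡ s ++ [ j ] × i ≢ j × s′ ∈ dom T × s″ ∈ dom T
    trans : ∀ s i j l → R (s ++ [ i ]) (s ++ [ j ]) ≡ true
            → R (s ++ [ j ]) (s ++ [ l ]) ≡ true → R (s ++ [ i ]) (s ++ [ l ]) ≡ true
    total : ∀ s i j → (s ++ [ i ]) ∈ dom T → (s ++ [ j ]) ∈ dom T → i ≢ j
            → R (s ++ [ i ]) (s ++ [ j ]) ≡ true ⊎ R (s ++ [ j ]) (s ++ [ i ]) ≡ true

Invariant : ∀ {k} → (UTree k → (Word → Word → Bool) → Set) → Formula k → Set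
Invariant {k} Adm φ = ∀ (T : UTree k) R₁ R₂ → Adm T R₁ → Adm T R₂ → (T , R₁ ⊨ φ) ⇔ (T , R₂ ⊨ φ)

DefinableInv : ∀ {k} → (UTree k → (Word → Word → Bool) → Set) → (UTree k → Set) → Set
DefinableInv {k} Adm S = Σ (Formula k) λ φ → Sentence φ × Invariant Adm φ ×
  (∀ (T : UTree k) → S T ⇔ (Σ (Word → Word → Bool) λ R → Adm T R × (T , R ⊨ φ)))

-- A linear order on the nodes restricts to a sibling order (keep the pairs of distinct
-- nodes with the same strict ancestors), and a sibling order extends to a linear order,
-- the document order (s precedes t iff s is a strict ancestor of t, or an ancestor-or-self
-- of s precedes an ancestor-or-self of t as siblings). Both constructions are MSO-definable
-- from the given relation, so substituting the defining formula for the atom R turns an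
-- invariant sentence of either kind into one of the other kind; invariance and the defined
-- set of trees carry over because every admissible relation of the new kind induces one of
-- the old kind, and admissible relations of both kinds exist on the same trees.
module Submission where

open import Defs
open import Data.Nat using (ℕ; suc; _+_; _≤_; s≤s; z≤n)
import Data.Nat as ℕ
open import Data.Nat.Properties using (m<m+n; <⇒≢; ≤-refl; m≤m+n; m≤n+m; m≤n⇒m≤1+n; ≤-antisym; <-irrefl; <ᵇ⇒<; <⇒<ᵇ)
open import Data.Bool using (Bool; true; false; _∧_; not)
open import Data.Bool.Properties using (∧-conicalˡ; ∧-conicalʳ; T-≡)
open import Data.Bool.ListAction using (or; any)
open import Data.List using (List; []; _∷_; _++_; [_]; _∷ʳ_; length; initLast; _∷ʳ′_)
open import Data.List.Properties using (map-cong; ++-assoc; ++-conicalʳ; ++-identityʳ; length-++; ∷-injective; ∷ʳ-injective; ≡-dec)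
open import Data.List.Membership.Propositional using (_∈_)
open import Data.List.Relation.Unary.Any using (here; there)
open import Data.Product using (Σ; ∃; ∃₂; _×_; _,_; proj₂)
open import Data.Sum using (_⊎_; inj₁; inj₂)
open import Data.Empty using (⊥-elim)
open import Relation.Nullary using (¬_; yes; no)
open import Relation.Binary.PropositionalEquality using (_≡_; _≢_; refl; sym; trans; cong; cong₂; subst; ≢-sym; module ≡-Reasoning)
open import Function.Bundles using (_⇔_; mk⇔; Equivalence)

WordRel : Set
WordRel = Word → Word → Bool

∧-intro : ∀ {a b} → a ≡ true → b ≡ true → a ∧ b ≡ true
∧-intro = cong₂ _∧_

∧-elim : ∀ a {b} → a ∧ b ≡ true → a ≡ true × b ≡ true
∧-elim true p = refl , p

true≢false : true ≢ false
true≢false ()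

not-true : ∀ {b} → not b ≡ true → b ≡ false
not-true {false} _ = refl

not-false : ∀ {b} → not b ≡ false → b ≡ true
not-false {true} _ = refl

any-cong : ∀ {A : Set} {f g : A → Bool} (xs : List A) → (∀ x → f x ≡ g x) → any f xs ≡ any g xs
any-cong xs f≗g = cong or (map-cong f≗g xs)

any-true⇒∃ : ∀ {A : Set} (f : A → Bool) xs → any f xs ≡ true → ∃ λ x → x ∈ xs × f x ≡ true
any-true⇒∃ f (x ∷ xs) p with f x in fx
... | true  = x , here refl , fx
... | false with any-true⇒∃ f xs p
...   | y , y∈xs , fy = y , there y∈xs , fy

∃⇒any-true : ∀ {A : Set} (f : A → Bool) xs {x} → x ∈ xs → f x ≡ true → any f xs ≡ true
∃⇒any-true f (x ∷ xs) (here refl) fx rewrite fx = refl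
∃⇒any-true f (y ∷ xs) (there x∈xs) fx with f y
... | true  = refl
... | false = ∃⇒any-true f xs x∈xs fx

any-false⇒∀ : ∀ {A : Set} (f : A → Bool) xs → any f xs ≡ false → ∀ {x} → x ∈ xs → f x ≡ false
any-false⇒∀ f (y ∷ xs) p (here refl) with f y
... | false = refl
any-false⇒∀ f (y ∷ xs) p (there x∈xs) with f y
... | false = any-false⇒∀ f xs p x∈xs

∀⇒any-false : ∀ {A : Set} (f : A → Bool) xs → (∀ {x} → x ∈ xs → f x ≡ false) → any f xs ≡ false
∀⇒any-false f []       all-false = refl
∀⇒any-false f (x ∷ xs) all-false rewrite all-false (here refl) = ∀⇒any-false f xs (λ m → all-false (there m))

=w-refl : ∀ s → s =w s ≡ true
=w-refl s with ≡-dec ℕ._≟_ s s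
... | yes _  = refl
... | no s≢s = ⊥-elim (s≢s refl)

=w⇒≡ : ∀ {s t} → s =w t ≡ true → s ≡ t
=w⇒≡ {s} {t} p with ≡-dec ℕ._≟_ s t
... | yes s≡t = s≡t

≢⇒=w-false : ∀ {s t} → s ≢ t → s =w t ≡ false
≢⇒=w-false {s} {t} s≢t with ≡-dec ℕ._≟_ s t
... | yes s≡t = ⊥-elim (s≢t s≡t)
... | no _    = refl

elemW⇒∈ : ∀ {s} D → elemW s D ≡ true → s ∈ D
elemW⇒∈ {s} D p with any-true⇒∃ (s =w_) D p
... | t , t∈D , s=t rewrite =w⇒≡ s=t = t∈D

∈⇒elemW : ∀ {s D} → s ∈ D → elemW s D ≡ true
∈⇒elemW {s} {D} s∈D = ∃⇒any-true (s =w_) D s∈D (=w-refl s)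

elemℕ-here : ∀ x b → elemℕ x (x ∷ b) ≡ true
elemℕ-here x b with x ℕ.≟ x
... | yes _  = refl
... | no x≢x = ⊥-elim (x≢x refl)

elemℕ-there : ∀ {x} y b → elemℕ x b ≡ true → elemℕ x (y ∷ b) ≡ true
elemℕ-there {x} y b p with x ℕ.≟ y
... | yes _ = refl
... | no _  = p

infix 4 _⊑_ _⊏_

_⊑_ : Word → Word → Set
s ⊑ t = ∃ λ r → s ++ r ≡ t

_⊏_ : Word → Word → Set
s ⊏ t = ∃₂ λ c r → s ++ c ∷ r ≡ t

⊑-refl : ∀ s → s ⊑ s
⊑-refl s = [] , ++-identityʳ s

⊑-trans : ∀ {a b c} → a ⊑ b → b ⊑ c → a ⊑ c
⊑-trans {a} (r , refl) (r′ , refl) = r ++ r′ , sym (++-assoc a r r′)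

⊏⇒⊑ : ∀ {a b} → a ⊏ b → a ⊑ b
⊏⇒⊑ (c , r , e) = c ∷ r , e

⊑-⊏-trans : ∀ {a b c} → a ⊑ b → b ⊏ c → a ⊏ c
⊑-⊏-trans {a} ([] , refl) (c , r , refl) = c , r , cong (_++ c ∷ r) (sym (++-identityʳ a))
⊑-⊏-trans {a} (d ∷ r , refl) (c , r′ , refl) = d , r ++ c ∷ r′ , sym (++-assoc a (d ∷ r) (c ∷ r′))

⊏-⊑-trans : ∀ {a b c} → a ⊏ b → b ⊑ c → a ⊏ c
⊏-⊑-trans {a} (c , r , refl) (r′ , refl) = c , r ++ r′ , sym (++-assoc a (c ∷ r) r′)

⊑-∷ʳ-self : ∀ p (i : ℕ) → p ⊑ p ∷ʳ i
⊑-∷ʳ-self p i = [ i ] , refl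

⊑⇒⊏-∷ʳ : ∀ {a p} i → a ⊑ p → a ⊏ p ∷ʳ i
⊑⇒⊏-∷ʳ i a⊑p = ⊑-⊏-trans a⊑p (i , [] , refl)

∷ʳ-≢ : ∀ s {i j : ℕ} → i ≢ j → s ∷ʳ i ≢ s ∷ʳ j
∷ʳ-≢ s i≢j e = i≢j (proj₂ (∷ʳ-injective s s e))

⊑-length : ∀ {a b} → a ⊑ b → length a ≤ length b
⊑-length {a} (r , refl) = subst (length a ≤_) (sym (length-++ a)) (m≤m+n _ _)

⊏-length : ∀ {a b} → a ⊏ b → length a ℕ.< length b
⊏-length {a} (c , r , refl) = subst (length a ℕ.<_) (sym (length-++ a)) (m<m+n (length a) (s≤s z≤n))

⊏-irrefl : ∀ {s} → ¬ s ⊏ s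
⊏-irrefl s⊏s = <-irrefl refl (⊏-length s⊏s)

⊑-length-≡ : ∀ {a b} → a ⊑ b → length a ≡ length b → a ≡ b
⊑-length-≡ {a} ([] , refl)    _     = sym (++-identityʳ a)
⊑-length-≡ {a} (c ∷ r , refl) |a|≡|b| = ⊥-elim (<-irrefl |a|≡|b| (⊏-length {a} (c , r , refl)))

⊑-antisym : ∀ {a b} → a ⊑ b → b ⊑ a → a ≡ b
⊑-antisym a⊑b b⊑a = ⊑-length-≡ a⊑b (≤-antisym (⊑-length a⊑b) (⊑-length b⊑a))

∷-⊑ : ∀ {x a b} → a ⊑ b → x ∷ a ⊑ x ∷ b
∷-⊑ (r , e) = r , cong (_ ∷_) e

⊑-∷ʳ : ∀ a p i → a ⊑ p ∷ʳ i → a ≡ p ∷ʳ i ⊎ a ⊑ p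
⊑-∷ʳ []      p       i _            = inj₂ (p , refl)
⊑-∷ʳ (x ∷ a) []      i ([] , e)     = inj₁ (trans (sym (++-identityʳ (x ∷ a))) e)
⊑-∷ʳ (x ∷ a) []      i (y ∷ r , e)  with ++-conicalʳ a (y ∷ r) (proj₂ (∷-injective e))
... | ()
⊑-∷ʳ (x ∷ a) (y ∷ p) i (r , e) with ∷-injective e
... | refl , e′ with ⊑-∷ʳ a p i (r , e′)
...   | inj₁ a≡pi = inj₁ (cong (x ∷_) a≡pi)
...   | inj₂ a⊑p  = inj₂ (∷-⊑ a⊑p)

⊏-∷ʳ⇒⊑ : ∀ {a} p i → a ⊏ p ∷ʳ i → a ⊑ p
⊏-∷ʳ⇒⊑ p i a⊏pi with ⊑-∷ʳ _ p i (⊏⇒⊑ a⊏pi)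
... | inj₁ refl = ⊥-elim (⊏-irrefl a⊏pi)
... | inj₂ a⊑p  = a⊑p

⊑-connex : ∀ a b {t} → a ⊑ t → b ⊑ t → a ⊑ b ⊎ b ⊑ a
⊑-connex []      b       _ _ = inj₁ (b , refl)
⊑-connex (x ∷ a) []      _ _ = inj₂ (x ∷ a , refl)
⊑-connex (x ∷ a) (y ∷ b) {z ∷ t} (r , e) (r′ , e′) with ∷-injective e | ∷-injective e′
... | refl , e₁ | refl , e₂ with ⊑-connex a b (r , e₁) (r′ , e₂)
...   | inj₁ a⊑b = inj₁ (∷-⊑ a⊑b)
...   | inj₂ b⊑a = inj₂ (∷-⊑ b⊑a)

data Fork : Word → Word → Set where
  fork : ∀ p {i j} r r′ → i ≢ j → Fork (p ++ i ∷ r) (p ++ j ∷ r′)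

compareWords : ∀ s t → s ⊑ t ⊎ t ⊑ s ⊎ Fork s t
compareWords []      t       = inj₁ (t , refl)
compareWords (x ∷ s) []      = inj₂ (inj₁ (x ∷ s , refl))
compareWords (x ∷ s) (y ∷ t) with x ℕ.≟ y
... | no x≢y = inj₂ (inj₂ (fork [] s t x≢y))
... | yes refl with compareWords s t
...   | inj₁ s⊑t                   = inj₁ (∷-⊑ s⊑t)
...   | inj₂ (inj₁ t⊑s)            = inj₂ (inj₁ (∷-⊑ t⊑s))
...   | inj₂ (inj₂ (fork p r r′ ne)) = inj₂ (inj₂ (fork (x ∷ p) r r′ ne))

isPrefix⇒⊑ : ∀ s t → isPrefix s t ≡ true → s ⊑ t
isPrefix⇒⊑ []      t       _ = t , refl
isPrefix⇒⊑ (x ∷ s) (y ∷ t) p with x ℕ.≟ y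
... | yes refl = ∷-⊑ (isPrefix⇒⊑ s t p)

⊑⇒isPrefix : ∀ {s t} → s ⊑ t → isPrefix s t ≡ true
⊑⇒isPrefix {[]}    _          = refl
⊑⇒isPrefix {x ∷ s} (r , refl) with x ℕ.≟ x
... | yes _  = ⊑⇒isPrefix {s} (r , refl)
... | no x≢x = ⊥-elim (x≢x refl)

isStrictPrefix⇒⊏ : ∀ s t → isStrictPrefix s t ≡ true → s ⊏ t
isStrictPrefix⇒⊏ s t p with isPrefix⇒⊑ s t (∧-conicalˡ _ _ p)
... | c ∷ r , e    = c , r , e
... | [] , refl    = ⊥-elim (<-irrefl (cong length (sym (++-identityʳ s)))
                       (<ᵇ⇒< (length s) _ (Equivalence.from T-≡ (∧-conicalʳ _ _ p))))

⊏⇒isStrictPrefix : ∀ {s t} → s ⊏ t → isStrictPrefix s t ≡ true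
⊏⇒isStrictPrefix s⊏t =
  ∧-intro (⊑⇒isPrefix (⊏⇒⊑ s⊏t)) (Equivalence.to T-≡ (<⇒<ᵇ (⊏-length s⊏t)))

isStrictPrefix-∷ʳ : ∀ u p i → isStrictPrefix u (p ∷ʳ i) ≡ isPrefix u p
isStrictPrefix-∷ʳ u p i with isPrefix u p in u⊑p | isStrictPrefix u (p ∷ʳ i) in u⊏pi
... | true  | true  = refl
... | false | false = refl
... | true  | false = sym (trans (sym (⊏⇒isStrictPrefix (⊑⇒⊏-∷ʳ i (isPrefix⇒⊑ u p u⊑p)))) u⊏pi)
... | false | true  = trans (sym (⊑⇒isPrefix (⊏-∷ʳ⇒⊑ p i (isStrictPrefix⇒⊏ u _ u⊏pi)))) u⊑p

-- Substituting a defined relation for the order atom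

substRel : ∀ {k} → (ℕ → ℕ → Formula k) → Formula k → Formula k
substRel θ (lab a x)  = lab a x
substRel θ (desc x y) = desc x y
substRel θ (rel x y)  = θ x y
substRel θ (eq x y)   = eq x y
substRel θ (mem x X)  = mem x X
substRel θ (neg φ)    = neg (substRel θ φ)
substRel θ (conj φ ψ) = conj (substRel θ φ) (substRel θ ψ)
substRel θ (ex1 x φ)  = ex1 x (substRel θ φ)
substRel θ (ex2 X φ)  = ex2 X (substRel θ φ)

Defines : ∀ {k} → (ℕ → ℕ → Formula k) → (UTree k → WordRel → WordRel) → Set
Defines θ F = ∀ T R e₁ e₂ x y → sat T R e₁ e₂ (θ x y) ≡ F T R (e₁ x) (e₁ y)

ClosedLikeRel : ∀ {k} → (ℕ → ℕ → Formula k) → Set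
ClosedLikeRel {k} θ =
  ∀ b₁ b₂ x y → closedIn b₁ b₂ (rel {k} x y) ≡ true → closedIn b₁ b₂ (θ x y) ≡ true

sat-substRel : ∀ {k} {θ : ℕ → ℕ → Formula k} {F} → Defines θ F →
  ∀ T R φ e₁ e₂ → sat T R e₁ e₂ (substRel θ φ) ≡ sat T (F T R) e₁ e₂ φ
sat-substRel θ⇔F T R (lab a x)  e₁ e₂ = refl
sat-substRel θ⇔F T R (desc x y) e₁ e₂ = refl
sat-substRel θ⇔F T R (rel x y)  e₁ e₂ = θ⇔F T R e₁ e₂ x y
sat-substRel θ⇔F T R (eq x y)   e₁ e₂ = refl
sat-substRel θ⇔F T R (mem x X)  e₁ e₂ = refl
sat-substRel θ⇔F T R (neg φ)    e₁ e₂ = cong not (sat-substRel θ⇔F T R φ e₁ e₂)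
sat-substRel θ⇔F T R (conj φ ψ) e₁ e₂ =
  cong₂ _∧_ (sat-substRel θ⇔F T R φ e₁ e₂) (sat-substRel θ⇔F T R ψ e₁ e₂)
sat-substRel θ⇔F T R (ex1 x φ)  e₁ e₂ =
  any-cong (dom T) λ s → sat-substRel θ⇔F T R φ (update e₁ x s) e₂
sat-substRel θ⇔F T R (ex2 X φ)  e₁ e₂ =
  any-cong (subsets (dom T)) λ S → sat-substRel θ⇔F T R φ e₁ (update e₂ X S)

closedIn-substRel : ∀ {k} {θ : ℕ → ℕ → Formula k} → ClosedLikeRel θ →
  ∀ φ b₁ b₂ → closedIn b₁ b₂ φ ≡ true → closedIn b₁ b₂ (substRel θ φ) ≡ true
closedIn-substRel θc (lab a x)  b₁ b₂ p = p
closedIn-substRel θc (desc x y) b₁ b₂ p = p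
closedIn-substRel θc (rel x y)  b₁ b₂ p = θc b₁ b₂ x y p
closedIn-substRel θc (eq x y)   b₁ b₂ p = p
closedIn-substRel θc (mem x X)  b₁ b₂ p = p
closedIn-substRel θc (neg φ)    b₁ b₂ p = closedIn-substRel θc φ b₁ b₂ p
closedIn-substRel θc (conj φ ψ) b₁ b₂ p =
  ∧-intro (closedIn-substRel θc φ b₁ b₂ (∧-conicalˡ _ _ p))
          (closedIn-substRel θc ψ b₁ b₂ (∧-conicalʳ _ _ p))
closedIn-substRel θc (ex1 x φ)  b₁ b₂ p = closedIn-substRel θc φ (x ∷ b₁) b₂ p
closedIn-substRel θc (ex2 X φ)  b₁ b₂ p = closedIn-substRel θc φ b₁ (X ∷ b₂) p

definableInv-transfer : ∀ {k} {Adm₁ Adm₂ : UTree k → WordRel → Set}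
  (θ : ℕ → ℕ → Formula k) (F : UTree k → WordRel → WordRel) →
  Defines θ F → ClosedLikeRel θ →
  (∀ T R → Adm₂ T R → Adm₁ T (F T R)) →
  (∀ T R → Adm₁ T R → ∃ (Adm₂ T)) →
  ∀ S → DefinableInv Adm₁ S → DefinableInv Adm₂ S
definableInv-transfer {Adm₂ = Adm₂} θ F θ⇔F θc F-adm adm₂-exists S (φ , φ-closed , φ-inv , φ-defines) =
  substRel θ φ , closedIn-substRel θc φ [] [] φ-closed , ψ-inv , ψ-defines
  where
  open Equivalence
  ∅ : ∀ {A : Set} → ℕ → List A
  ∅ _ = []
  ψ≡φ∘F : ∀ T R → sat T R ∅ ∅ (substRel θ φ) ≡ sat T (F T R) ∅ ∅ φ
  ψ≡φ∘F T R = sat-substRel θ⇔F T R φ ∅ ∅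

  ψ-inv : Invariant Adm₂ (substRel θ φ)
  ψ-inv T R₁ R₂ a₁ a₂ = mk⇔
    (λ p → trans (ψ≡φ∘F T R₂) (to   φ-inv′ (trans (sym (ψ≡φ∘F T R₁)) p)))
    (λ p → trans (ψ≡φ∘F T R₁) (from φ-inv′ (trans (sym (ψ≡φ∘F T R₂)) p)))
    where
    φ-inv′ : (T , F T R₁ ⊨ φ) ⇔ (T , F T R₂ ⊨ φ)
    φ-inv′ = φ-inv T (F T R₁) (F T R₂) (F-adm T R₁ a₁) (F-adm T R₂ a₂)

  ψ-defines : ∀ T → S T ⇔ (Σ WordRel λ R → Adm₂ T R × (T , R ⊨ substRel θ φ))
  ψ-defines T = mk⇔ sound complete
    where
    sound : S T → Σ WordRel λ R → Adm₂ T R × (T , R ⊨ substRel θ φ)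
    sound ST with to (φ-defines T) ST
    ... | R₀ , a₀ , T⊨φ with adm₂-exists T R₀ a₀
    ...   | R , a = R , a , trans (ψ≡φ∘F T R) (to (φ-inv T R₀ (F T R) a₀ (F-adm T R a)) T⊨φ)
    complete : (Σ WordRel λ R → Adm₂ T R × (T , R ⊨ substRel θ φ)) → S T
    complete (R , a , T⊨ψ) = from (φ-defines T) (F T R , F-adm T R a , trans (sym (ψ≡φ∘F T R)) T⊨ψ)

orF : ∀ {k} → Formula k → Formula k → Formula k
orF φ ψ = neg (conj (neg φ) (neg ψ))

iffF : ∀ {k} → Formula k → Formula k → Formula k
iffF φ ψ = conj (neg (conj φ (neg ψ))) (neg (conj ψ (neg φ)))

orB : Bool → Bool → Bool
orB a b = not (not a ∧ not b)

iffB : Bool → Bool → Bool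
iffB a b = not (a ∧ not b) ∧ not (b ∧ not a)

orB-elim : ∀ a b → orB a b ≡ true → a ≡ true ⊎ b ≡ true
orB-elim true  b    _ = inj₁ refl
orB-elim false true _ = inj₂ refl

orB-introˡ : ∀ {a} b → a ≡ true → orB a b ≡ true
orB-introˡ b refl = refl

orB-introʳ : ∀ a {b} → b ≡ true → orB a b ≡ true
orB-introʳ true  refl = refl
orB-introʳ false refl = refl

iffB⇒≡ : ∀ a b → iffB a b ≡ true → a ≡ b
iffB⇒≡ true  true  _ = refl
iffB⇒≡ false false _ = refl

iffB-refl : ∀ a → iffB a a ≡ true
iffB-refl true  = refl
iffB-refl false = refl

≤⇒≢suc : ∀ {m n} → m ≤ n → m ≢ suc n
≤⇒≢suc m≤n = <⇒≢ (s≤s m≤n)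

update-same : ∀ {A : Set} (e : ℕ → A) x a → update e x a x ≡ a
update-same e x a with x ℕ.≟ x
... | yes _  = refl
... | no x≢x = ⊥-elim (x≢x refl)

update-other : ∀ {A : Set} (e : ℕ → A) {x} a {y} → y ≢ x → update e x a y ≡ e y
update-other e {x} a {y} y≢x with y ℕ.≟ x
... | yes y≡x = ⊥-elim (y≢x y≡x)
... | no _    = refl

-- The sibling order induced by a linear order

SameAncestors : ∀ {k} → UTree k → Word → Word → Set
SameAncestors T s t = ∀ {u} → u ∈ dom T → isStrictPrefix u s ≡ isStrictPrefix u t

restrictToSiblings : ∀ {k} → UTree k → WordRel → WordRel
restrictToSiblings T R s t = R s t ∧ (not (s =w t) ∧
  not (any (λ u → not (iffB (isStrictPrefix u s) (isStrictPrefix u t))) (dom T)))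

-- suc (x + y) differs from x and y, so it can be bound without capturing them.
restrictToSiblingsF : ∀ {k} → ℕ → ℕ → Formula k
restrictToSiblingsF x y = conj (rel x y) (conj (neg (eq x y))
  (neg (ex1 z (neg (iffF (desc z x) (desc z y))))))
  where
  z : ℕ
  z = suc (x + y)

sat-restrictToSiblingsF : ∀ {k} → Defines (restrictToSiblingsF {k}) restrictToSiblings
sat-restrictToSiblingsF T R e₁ e₂ x y =
  cong (λ b → R (e₁ x) (e₁ y) ∧ (not (e₁ x =w e₁ y) ∧ not b)) (any-cong (dom T) λ u →
    cong₂ (λ a b → not (iffB a b))
      (cong₂ isStrictPrefix (update-same e₁ z u) (update-other e₁ u (≤⇒≢suc (m≤m+n x y))))
      (cong₂ isStrictPrefix (update-same e₁ z u) (update-other e₁ u (≤⇒≢suc (m≤n+m y x)))))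
  where
  z : ℕ
  z = suc (x + y)

closedIn-restrictToSiblingsF : ∀ {k} → ClosedLikeRel (restrictToSiblingsF {k})
closedIn-restrictToSiblingsF b₁ b₂ x y p =
  ∧-intro p (∧-intro p (∧-intro (∧-intro z≺x z≺y) (∧-intro z≺y z≺x)))
  where
  z : ℕ
  z = suc (x + y)
  z≺x : elemℕ z (z ∷ b₁) ∧ elemℕ x (z ∷ b₁) ≡ true
  z≺x = ∧-intro (elemℕ-here z b₁) (elemℕ-there z b₁ (∧-conicalˡ _ _ p))
  z≺y : elemℕ z (z ∷ b₁) ∧ elemℕ y (z ∷ b₁) ≡ true
  z≺y = ∧-intro (elemℕ-here z b₁) (elemℕ-there z b₁ (∧-conicalʳ _ _ p))

module _ {k} (T : UTree k) where

  sameAncestors-∷ʳ : ∀ p i j → SameAncestors T (p ∷ʳ i) (p ∷ʳ j)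
  sameAncestors-∷ʳ p i j {u} _ = trans (isStrictPrefix-∷ʳ u p i) (sym (isStrictPrefix-∷ʳ u p j))

  root-hasNoSibling : ∀ {q j} → q ∷ʳ j ∈ dom T → ¬ SameAncestors T [] (q ∷ʳ j)
  root-hasNoSibling {q} {j} qj∈D same
    with trans (same {[]} (prefixClosed T qj∈D)) (⊏⇒isStrictPrefix {[]} {q ∷ʳ j} (⊑⇒⊏-∷ʳ j (q , refl)))
  ... | ()

  sameAncestors-symmetric : ∀ {s t} → SameAncestors T s t → SameAncestors T t s
  sameAncestors-symmetric same u∈D = sym (same u∈D)

  -- A node is a strict ancestor of its children, so equal ancestor sets force equal parents.
  sameAncestors⇒parent-⊑ : ∀ {p q i j} → p ∈ dom T → SameAncestors T (p ∷ʳ i) (q ∷ʳ j) → p ⊑ q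
  sameAncestors⇒parent-⊑ {p} {q} {i} {j} p∈D same = isPrefix⇒⊑ p q (begin
    isPrefix p q               ≡⟨ isStrictPrefix-∷ʳ p q j ⟨
    isStrictPrefix p (q ∷ʳ j)  ≡⟨ same p∈D ⟨
    isStrictPrefix p (p ∷ʳ i)  ≡⟨ ⊏⇒isStrictPrefix (⊑⇒⊏-∷ʳ {p} i (⊑-refl p)) ⟩
    true                       ∎)
    where open ≡-Reasoning

  sameAncestors⇒siblings : ∀ {s t} → s ∈ dom T → t ∈ dom T → s ≢ t → SameAncestors T s t →
    ∃ λ p → ∃₂ λ i j → s ≡ p ∷ʳ i × t ≡ p ∷ʳ j
  sameAncestors⇒siblings {s} {t} s∈D t∈D s≢t same with initLast s | initLast t
  ... | []       | []       = ⊥-elim (s≢t refl)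
  ... | []       | q ∷ʳ′ j  = ⊥-elim (root-hasNoSibling t∈D same)
  ... | p ∷ʳ′ i  | []       = ⊥-elim (root-hasNoSibling s∈D (sameAncestors-symmetric same))
  ... | p ∷ʳ′ i  | q ∷ʳ′ j  = p , i , j , refl , cong (_∷ʳ j) (sym (⊑-antisym p⊑q q⊑p))
    where
    p⊑q : p ⊑ q
    p⊑q = sameAncestors⇒parent-⊑ (prefixClosed T s∈D) same
    q⊑p : q ⊑ p
    q⊑p = sameAncestors⇒parent-⊑ (prefixClosed T t∈D) (sameAncestors-symmetric same)

module _ {k} (T : UTree k) (R : WordRel) where

  restrictToSiblings⇒ : ∀ {s t} → restrictToSiblings T R s t ≡ true →
    R s t ≡ true × s ≢ t × SameAncestors T s t
  restrictToSiblings⇒ {s} {t} p with ∧-elim (R s t) p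
  ... | r , q with ∧-elim (not (s =w t)) q
  ...   | s≠t , noDifference = r , s≢t , same
    where
    s≢t : s ≢ t
    s≢t s≡t = true≢false (trans (sym (subst (λ v → s =w v ≡ true) s≡t (=w-refl s))) (not-true s≠t))
    same : SameAncestors T s t
    same u∈D = iffB⇒≡ _ _ (not-false (any-false⇒∀ _ (dom T) (not-true noDifference) u∈D))

  ⇒restrictToSiblings : ∀ {s t} → R s t ≡ true → s ≢ t → SameAncestors T s t →
    restrictToSiblings T R s t ≡ true
  ⇒restrictToSiblings {s} {t} r s≢t same = ∧-intro r (∧-intro (cong not (≢⇒=w-false s≢t))
    (cong not (∀⇒any-false _ (dom T) λ {u} u∈D →
      cong not (subst (λ b → iffB (isStrictPrefix u s) b ≡ true) (same u∈D) (iffB-refl (isStrictPrefix u s))))))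

  restrictToSiblings-isSiblingOrder : IsLinearOrder T R → IsSiblingOrder T (restrictToSiblings T R)
  restrictToSiblings-isSiblingOrder L = record { shape = shape ; trans = trans′ ; total = total }
    where
    module L = IsLinearOrder L

    R⇒≢ : ∀ {a b} → R a b ≡ true → a ≢ b
    R⇒≢ {a} r refl = true≢false (trans (sym r) (L.irrefl a))

    shape : ∀ s′ s″ → restrictToSiblings T R s′ s″ ≡ true →
      Σ Word λ s → Σ ℕ λ i → Σ ℕ λ j →
        s′ ≡ s ∷ʳ i × s″ ≡ s ∷ʳ j × i ≢ j × s′ ∈ dom T × s″ ∈ dom T
    shape s′ s″ p with restrictToSiblings⇒ p
    ... | r , s′≢s″ , same with L.onDom s′ s″ r
    ...   | s′∈D , s″∈D with sameAncestors⇒siblings T s′∈D s″∈D s′≢s″ same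
    ...     | s , i , j , refl , refl =
      s , i , j , refl , refl , (λ i≡j → s′≢s″ (cong (s ∷ʳ_) i≡j)) , s′∈D , s″∈D

    trans′ : ∀ s i j l → restrictToSiblings T R (s ∷ʳ i) (s ∷ʳ j) ≡ true →
      restrictToSiblings T R (s ∷ʳ j) (s ∷ʳ l) ≡ true → restrictToSiblings T R (s ∷ʳ i) (s ∷ʳ l) ≡ true
    trans′ s i j l p q with restrictToSiblings⇒ p | restrictToSiblings⇒ q
    ... | r₁ , _ , same₁ | r₂ , _ , same₂ =
      ⇒restrictToSiblings (L.trans _ _ _ r₁ r₂)
        (R⇒≢ (L.trans _ _ _ r₁ r₂))
        (λ u∈D → trans (same₁ u∈D) (same₂ u∈D))

    total : ∀ s i j → s ∷ʳ i ∈ dom T → s ∷ʳ j ∈ dom T → i ≢ j →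
      restrictToSiblings T R (s ∷ʳ i) (s ∷ʳ j) ≡ true ⊎ restrictToSiblings T R (s ∷ʳ j) (s ∷ʳ i) ≡ true
    total s i j si∈D sj∈D i≢j with L.total _ _ si∈D sj∈D (∷ʳ-≢ s i≢j)
    ... | inj₁ r = inj₁ (⇒restrictToSiblings r (∷ʳ-≢ s i≢j) (sameAncestors-∷ʳ T s i j))
    ... | inj₂ r = inj₂ (⇒restrictToSiblings r (∷ʳ-≢ s (≢-sym i≢j)) (sameAncestors-∷ʳ T s j i))

-- The document order induced by a sibling order

isAncestorOrSelf : Word → Word → Bool
isAncestorOrSelf a s = orB (a =w s) (isStrictPrefix a s)

relatedAncestors : WordRel → Word → Word → Word → Word → Bool
relatedAncestors R s t a b = isAncestorOrSelf a s ∧ (isAncestorOrSelf b t ∧ R a b)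

documentBeforeᵇ : ∀ {k} → UTree k → WordRel → WordRel
documentBeforeᵇ T R s t =
  orB (isStrictPrefix s t) (any (λ a → any (relatedAncestors R s t a) (dom T)) (dom T))

documentOrder : ∀ {k} → UTree k → WordRel → WordRel
documentOrder T R s t = elemW s (dom T) ∧ (elemW t (dom T) ∧ documentBeforeᵇ T R s t)

-- The conjuncts ∃z. x = z keep the relation inside the domain, as IsLinearOrder.onDom requires.
documentOrderF : ∀ {k} → ℕ → ℕ → Formula k
documentOrderF x y = conj (ex1 z (eq x z)) (conj (ex1 z (eq y z)) (orF (desc x y)
  (ex1 z (ex1 w (conj (orF (eq z x) (desc z x)) (conj (orF (eq w y) (desc w y)) (rel z w)))))))
  where
  z w : ℕ
  z = suc (x + y)
  w = suc z

sat-documentOrderF : ∀ {k} → Defines (documentOrderF {k}) documentOrder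
sat-documentOrderF T R e₁ e₂ x y =
  cong₂ _∧_ (inDom x≢z) (cong₂ _∧_ (inDom y≢z) (cong (orB (isStrictPrefix (e₁ x) (e₁ y)))
    (any-cong (dom T) λ a → any-cong (dom T) λ b →
      cong₂ (λ (a , b) (s , t) → relatedAncestors R s t a b)
        (cong₂ _,_ (e′-z a b) (update-same (update e₁ z a) w b))
        (cong₂ _,_ (e′-old a b x≢z x≢w) (e′-old a b y≢z y≢w)))))
  where
  z w : ℕ
  z = suc (x + y)
  w = suc z
  e′ : Word → Word → ℕ → Word
  e′ a b = update (update e₁ z a) w b
  x≢z : x ≢ z
  x≢z = ≤⇒≢suc (m≤m+n x y)
  y≢z : y ≢ z
  y≢z = ≤⇒≢suc (m≤n+m y x)
  x≢w : x ≢ w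
  x≢w = ≤⇒≢suc (m≤n⇒m≤1+n (m≤m+n x y))
  y≢w : y ≢ w
  y≢w = ≤⇒≢suc (m≤n⇒m≤1+n (m≤n+m y x))
  z≢w : z ≢ w
  z≢w = ≤⇒≢suc (≤-refl {z})
  e′-z : ∀ a b → e′ a b z ≡ a
  e′-z a b = trans (update-other (update e₁ z a) b z≢w) (update-same e₁ z a)
  e′-old : ∀ a b {v} → v ≢ z → v ≢ w → e′ a b v ≡ e₁ v
  e′-old a b v≢z v≢w = trans (update-other (update e₁ z a) b v≢w) (update-other e₁ a v≢z)
  inDom : ∀ {v} → v ≢ z → sat T R e₁ e₂ (ex1 z (eq v z)) ≡ elemW (e₁ v) (dom T)
  inDom v≢z = any-cong (dom T) λ u → cong₂ _=w_ (update-other e₁ u v≢z) (update-same e₁ z u)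

closedIn-documentOrderF : ∀ {k} → ClosedLikeRel (documentOrderF {k})
closedIn-documentOrderF b₁ b₂ x y p =
  ∧-intro (∧-intro (elemℕ-there z b₁ x∈b₁) (elemℕ-here z b₁))
    (∧-intro (∧-intro (elemℕ-there z b₁ y∈b₁) (elemℕ-here z b₁))
      (∧-intro p (∧-intro (∧-intro (∧-intro z∈ x∈) (∧-intro z∈ x∈))
                          (∧-intro (∧-intro (∧-intro w∈ y∈) (∧-intro w∈ y∈)) (∧-intro z∈ w∈)))))
  where
  z w : ℕ
  z = suc (x + y)
  w = suc z
  x∈b₁ : elemℕ x b₁ ≡ true
  x∈b₁ = ∧-conicalˡ _ _ p
  y∈b₁ : elemℕ y b₁ ≡ true
  y∈b₁ = ∧-conicalʳ _ _ p
  z∈ : elemℕ z (w ∷ z ∷ b₁) ≡ true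
  z∈ = elemℕ-there w (z ∷ b₁) (elemℕ-here z b₁)
  w∈ : elemℕ w (w ∷ z ∷ b₁) ≡ true
  w∈ = elemℕ-here w (z ∷ b₁)
  x∈ : elemℕ x (w ∷ z ∷ b₁) ≡ true
  x∈ = elemℕ-there w (z ∷ b₁) (elemℕ-there z b₁ x∈b₁)
  y∈ : elemℕ y (w ∷ z ∷ b₁) ≡ true
  y∈ = elemℕ-there w (z ∷ b₁) (elemℕ-there z b₁ y∈b₁)

isAncestorOrSelf⇒⊑ : ∀ a s → isAncestorOrSelf a s ≡ true → a ⊑ s
isAncestorOrSelf⇒⊑ a s p with orB-elim (a =w s) _ p
... | inj₁ a=s rewrite =w⇒≡ a=s = ⊑-refl s
... | inj₂ a⊏s = ⊏⇒⊑ (isStrictPrefix⇒⊏ a s a⊏s)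

⊑⇒isAncestorOrSelf : ∀ {a s} → a ⊑ s → isAncestorOrSelf a s ≡ true
⊑⇒isAncestorOrSelf {a} ([] , refl)    =
  orB-introˡ _ (subst (λ v → a =w v ≡ true) (sym (++-identityʳ a)) (=w-refl a))
⊑⇒isAncestorOrSelf {a} (c ∷ r , refl) = orB-introʳ (a =w _) (⊏⇒isStrictPrefix {a} (c , r , refl))

⊑⇒≡⊎⊏ : ∀ {s t} → s ⊑ t → s ≡ t ⊎ s ⊏ t
⊑⇒≡⊎⊏ {s} ([] , refl)    = inj₁ (sym (++-identityʳ s))
⊑⇒≡⊎⊏     (c ∷ r , s++cr≡t) = inj₂ (c , r , s++cr≡t)

∷ʳ-⊑-++ : ∀ p i r → p ∷ʳ i ⊑ p ++ i ∷ r
∷ʳ-⊑-++ p i r = r , ++-assoc p [ i ] r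

siblings-⊑-same : ∀ {p i j t} → p ∷ʳ i ⊑ t → p ∷ʳ j ⊑ t → i ≡ j
siblings-⊑-same {p} {i} {j} pi⊑t pj⊑t = proj₂ (∷ʳ-injective p p pi≡pj)
  where
  same-length : length (p ∷ʳ i) ≡ length (p ∷ʳ j)
  same-length = trans (length-++ p) (sym (length-++ p))
  pi≡pj : p ∷ʳ i ≡ p ∷ʳ j
  pi≡pj with ⊑-connex (p ∷ʳ i) (p ∷ʳ j) pi⊑t pj⊑t
  ... | inj₁ pi⊑pj = ⊑-length-≡ pi⊑pj same-length
  ... | inj₂ pj⊑pi = sym (⊑-length-≡ pj⊑pi (sym same-length))

∷ʳ∈dom : ∀ {k} (T : UTree k) p {i} r → p ++ i ∷ r ∈ dom T → p ∷ʳ i ∈ dom T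
∷ʳ∈dom T p r m = prefixClosed T (subst (_∈ dom T) (sym (++-assoc p _ r)) m)

DocumentBefore : WordRel → Word → Word → Set
DocumentBefore R s t = s ⊏ t ⊎ ∃₂ λ a b → a ⊑ s × b ⊑ t × R a b ≡ true

module _ {k} (T : UTree k) (R : WordRel) where

  documentBeforeᵇ⇒ : ∀ {s t} → documentBeforeᵇ T R s t ≡ true → DocumentBefore R s t
  documentBeforeᵇ⇒ {s} {t} p with orB-elim (isStrictPrefix s t) _ p
  ... | inj₁ s⊏t = inj₁ (isStrictPrefix⇒⊏ s t s⊏t)
  ... | inj₂ found with any-true⇒∃ _ (dom T) found
  ...   | a , _ , found-b with any-true⇒∃ _ (dom T) found-b
  ...     | b , _ , related with ∧-elim (isAncestorOrSelf a s) related
  ...       | a≼s , related′ with ∧-elim (isAncestorOrSelf b t) related′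
  ...         | b≼t , r = inj₂ (a , b , isAncestorOrSelf⇒⊑ a s a≼s , isAncestorOrSelf⇒⊑ b t b≼t , r)

  documentOrder⇒ : ∀ {s t} → documentOrder T R s t ≡ true →
    s ∈ dom T × t ∈ dom T × DocumentBefore R s t
  documentOrder⇒ {s} {t} p with ∧-elim (elemW s (dom T)) p
  ... | s∈D , q with ∧-elim (elemW t (dom T)) q
  ...   | t∈D , before = elemW⇒∈ (dom T) s∈D , elemW⇒∈ (dom T) t∈D , documentBeforeᵇ⇒ before

  module _ (SO : IsSiblingOrder T R) where
    private module S = IsSiblingOrder SO

    ⇒documentBeforeᵇ : ∀ {s t} → DocumentBefore R s t → documentBeforeᵇ T R s t ≡ true
    ⇒documentBeforeᵇ {s} (inj₁ s⊏t) = orB-introˡ _ (⊏⇒isStrictPrefix {s} s⊏t)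
    ⇒documentBeforeᵇ {s} {t} (inj₂ (a , b , a⊑s , b⊑t , r)) with S.shape a b r
    ... | _ , _ , _ , _ , _ , _ , a∈D , b∈D =
      orB-introʳ (isStrictPrefix s t) (∃⇒any-true _ (dom T) a∈D (∃⇒any-true _ (dom T) b∈D
        (∧-intro (⊑⇒isAncestorOrSelf a⊑s) (∧-intro (⊑⇒isAncestorOrSelf b⊑t) r))))

    ⇒documentOrder : ∀ {s t} → s ∈ dom T → t ∈ dom T → DocumentBefore R s t →
      documentOrder T R s t ≡ true
    ⇒documentOrder s∈D t∈D before =
      ∧-intro (∈⇒elemW s∈D) (∧-intro (∈⇒elemW t∈D) (⇒documentBeforeᵇ before))

    documentBefore-irrefl : ∀ {s} → ¬ DocumentBefore R s s
    documentBefore-irrefl (inj₁ s⊏s) = ⊏-irrefl s⊏s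
    documentBefore-irrefl (inj₂ (a , b , a⊑s , b⊑s , r)) with S.shape a b r
    ... | _ , _ , _ , refl , refl , i≢j , _ = i≢j (siblings-⊑-same a⊑s b⊑s)

    sibling-trans : ∀ {a b c d} → R a b ≡ true → b ≡ c → R c d ≡ true → R a d ≡ true
    sibling-trans {a} {b} {c} {d} r₁ b≡c r₂ with S.shape a b r₁ | S.shape c d r₂
    ... | p , i , j , refl , refl , _ | q , _ , l , refl , refl , _ with ∷ʳ-injective p q b≡c
    ...   | refl , refl = S.trans p i j l r₁ r₂

    documentBefore-trans : ∀ {s t u} → DocumentBefore R s t → DocumentBefore R t u → DocumentBefore R s u
    documentBefore-trans (inj₁ s⊏t) (inj₁ t⊏u) = inj₁ (⊏-⊑-trans s⊏t (⊏⇒⊑ t⊏u))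
    documentBefore-trans (inj₂ (a , b , a⊑s , b⊑t , r)) (inj₁ t⊏u) =
      inj₂ (a , b , a⊑s , ⊑-trans b⊑t (⊏⇒⊑ t⊏u) , r)
    documentBefore-trans {s} (inj₁ s⊏t) (inj₂ (c , d , c⊑t , d⊑u , r)) with S.shape c d r
    ... | q , k , l , refl , refl , _ with ⊑-connex s (q ∷ʳ k) (⊏⇒⊑ s⊏t) c⊑t
    ...   | inj₂ c⊑s = inj₂ (_ , _ , c⊑s , d⊑u , r)
    ...   | inj₁ s⊑c with ⊑-∷ʳ s q k s⊑c
    ...     | inj₁ refl = inj₂ (_ , _ , ⊑-refl _ , d⊑u , r)
    ...     | inj₂ s⊑q  = inj₁ (⊏-⊑-trans (⊑⇒⊏-∷ʳ l s⊑q) d⊑u)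
    documentBefore-trans (inj₂ (a , b , a⊑s , b⊑t , r₁)) (inj₂ (c , d , c⊑t , d⊑u , r₂))
      with S.shape a b r₁ | S.shape c d r₂
    ... | p , i , j , refl , refl , _ | q , k , l , refl , refl , _ with ⊑-connex (p ∷ʳ j) (q ∷ʳ k) b⊑t c⊑t
    ...   | inj₁ b⊑c with ⊑-∷ʳ (p ∷ʳ j) q k b⊑c
    ...     | inj₁ b≡c = inj₂ (_ , _ , a⊑s , d⊑u , sibling-trans r₁ b≡c r₂)
    ...     | inj₂ b⊑q = inj₂ (_ , _ , a⊑s , ⊑-trans b⊑q (⊑-trans (⊑-∷ʳ-self q l) d⊑u) , r₁)
    documentBefore-trans (inj₂ (a , b , a⊑s , b⊑t , r₁)) (inj₂ (c , d , c⊑t , d⊑u , r₂))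
        | p , i , j , refl , refl , _ | q , k , l , refl , refl , _ | inj₂ c⊑b with ⊑-∷ʳ (q ∷ʳ k) p j c⊑b
    ...     | inj₁ c≡b = inj₂ (_ , _ , a⊑s , d⊑u , sibling-trans r₁ (sym c≡b) r₂)
    ...     | inj₂ c⊑p = inj₂ (_ , _ , ⊑-trans c⊑p (⊑-trans (⊑-∷ʳ-self p i) a⊑s) , d⊑u , r₂)

    -- Two incomparable nodes are ordered by the sibling order at the point where they fork.
    documentBefore-total : ∀ {s t} → s ∈ dom T → t ∈ dom T → s ≢ t →
      DocumentBefore R s t ⊎ DocumentBefore R t s
    documentBefore-total {s} {t} s∈D t∈D s≢t with compareWords s t
    ... | inj₁ s⊑t with ⊑⇒≡⊎⊏ s⊑t
    ...   | inj₁ s≡t = ⊥-elim (s≢t s≡t)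
    ...   | inj₂ s⊏t = inj₁ (inj₁ s⊏t)
    documentBefore-total {s} {t} s∈D t∈D s≢t | inj₂ (inj₁ t⊑s) with ⊑⇒≡⊎⊏ t⊑s
    ...   | inj₁ t≡s = ⊥-elim (s≢t (sym t≡s))
    ...   | inj₂ t⊏s = inj₂ (inj₁ t⊏s)
    documentBefore-total s∈D t∈D s≢t | inj₂ (inj₂ (fork p r r′ i≢j))
      with S.total p _ _ (∷ʳ∈dom T p r s∈D) (∷ʳ∈dom T p r′ t∈D) i≢j
    ... | inj₁ pi<pj = inj₁ (inj₂ (_ , _ , ∷ʳ-⊑-++ p _ r , ∷ʳ-⊑-++ p _ r′ , pi<pj))
    ... | inj₂ pj<pi = inj₂ (inj₂ (_ , _ , ∷ʳ-⊑-++ p _ r′ , ∷ʳ-⊑-++ p _ r , pj<pi))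

    documentOrder-isLinearOrder : IsLinearOrder T (documentOrder T R)
    documentOrder-isLinearOrder = record { onDom = onDom ; irrefl = irrefl ; trans = trans′ ; total = total }
      where
      onDom : ∀ s t → documentOrder T R s t ≡ true → s ∈ dom T × t ∈ dom T
      onDom s t p with documentOrder⇒ p
      ... | s∈D , t∈D , _ = s∈D , t∈D
      irrefl : ∀ s → documentOrder T R s s ≡ false
      irrefl s with documentOrder T R s s in p
      ... | false = refl
      ... | true  = ⊥-elim (documentBefore-irrefl (proj₂ (proj₂ (documentOrder⇒ p))))
      trans′ : ∀ s t u → documentOrder T R s t ≡ true → documentOrder T R t u ≡ true →
        documentOrder T R s u ≡ true
      trans′ s t u p q with documentOrder⇒ p | documentOrder⇒ q
      ... | s∈D , _ , s<t | _ , u∈D , t<u = ⇒documentOrder s∈D u∈D (documentBefore-trans s<t t<u)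
      total : ∀ s t → s ∈ dom T → t ∈ dom T → s ≢ t →
        documentOrder T R s t ≡ true ⊎ documentOrder T R t s ≡ true
      total s t s∈D t∈D s≢t with documentBefore-total s∈D t∈D s≢t
      ... | inj₁ s<t = inj₁ (⇒documentOrder s∈D t∈D s<t)
      ... | inj₂ t<s = inj₂ (⇒documentOrder t∈D s∈D t<s)

lemma4 : (k : ℕ) (S : UTree k → Set) →
    DefinableInv IsLinearOrder S ⇔ DefinableInv IsSiblingOrder S
lemma4 k S = mk⇔
  (definableInv-transfer documentOrderF documentOrder
    sat-documentOrderF (closedIn-documentOrderF {k})
    documentOrder-isLinearOrder
    (λ T R L → restrictToSiblings T R , restrictToSiblings-isSiblingOrder T R L) S)
  (definableInv-transfer restrictToSiblingsF restrictToSiblings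
    sat-restrictToSiblingsF (closedIn-restrictToSiblingsF {k})
    restrictToSiblings-isSiblingOrder
    (λ T R SO → documentOrder T R , documentOrder-isLinearOrder T R SO) S)
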